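{- For each $m\ge 2$, the stepping sequence $R_m$ is strongly contiguous, and hence gives rise to a cyclic Gray-code ordering on the $m$-bit integers. More generally, if $A$ and $B$ are strongly contiguous stepping sequences for $m-1$, then $C=(A+1)\cup[1,2,\ldots,m-1]\cup B$ is a strongly contiguous stepping sequence for $m$.
   Context: Let $n\ge1$ and start with the chain $S_i=\{0,1,\ldots,i-1\}$, $0\le i\le n$. A move with index $i$ ($1\le i\le n-1$) replaces $S_i$ by $S_{i-1}\cup(S_{i+1}\setminus S_i)$; the set produced is the new $S_i$. A sequence $[i_1,\ldots,i_N]$ with entries in $\{1,\ldots,n-1\}$ is a stepping sequence for $n$ if the initial sets $S_0,\ldots,S_n$ together with the sets produced by the successive moves $i_1,\ldots,i_N$ contain every subset of $\{0,\ldots,n-1\}$ exactly once. The stepping sequence gives rise to the list of $n$-bit integers obtained by mapping each set $S$ to $\sum_{i\in S}2^i$ in the order $S_0,S_1,\ldots,S_n$ (initial sets) followed by the produced sets; this is a cyclic Gray-code ordering if consecutive integers, and also the last and first integers, differ in exactly one bit. A sequence is contiguous if consecutive entries differ by $\pm1$; a stepping sequence for $n$ is strongly contiguous if it is contiguous, begins with $n-1$ and ends with $1$. $\cup$ is concatenation and $A+1$ adds $1$ to each entry of $A$. The sequences $R_m$ are defined by $R_2=[1]$ and $R_m=(R_{m-1}+1)\cup[1,2,\ldots,m-1]\cup R_{m-1}$ for $m\ge 3$. -}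

module Defs where

open import Data.Bool using (Bool; true; false; if_then_else_)
open import Data.Nat using (ℕ; zero; suc; _+_; _*_; _∸_; _^_; _≤_; _<ᵇ_; _≡ᵇ_; _/_; _%_)
open import Data.Fin using (Fin; toℕ)
open import Data.Fin.Subset using (Subset; _∪_; _─_; _∈_)
open import Data.Fin.Subset.Properties using (_∈?_)
open import Data.Vec using (tabulate; toList; zip)
open import Data.List using (List; []; _∷_; _++_; map; upTo)
open import Data.Nat.ListAction using (sum)
open import Data.List.Relation.Unary.All using (All)
open import Data.List.Relation.Unary.Linked using (Linked)
open import Data.List.Relation.Unary.Unique.Propositional using (Unique)
import Data.List.Membership.Propositional as LM
open import Data.Product using (Σ; _×_)
open import Data.Sum using (_⊎_)
open import Data.Unit using (⊤)
open import Relation.Nullary using (¬_; does)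
open import Relation.Binary.PropositionalEquality using (_≡_; _≢_)

-- A chain of sets S_0, S_1, ... (only indices 0..n are meaningful).
Chain : ℕ → Set
Chain n = ℕ → Subset n

initChain : (n : ℕ) → Chain n
initChain n i = tabulate (λ j → toℕ j <ᵇ i)

produced : {n : ℕ} → Chain n → ℕ → Subset n
produced S i = S (i ∸ 1) ∪ (S (suc i) ─ S i)

move : {n : ℕ} → Chain n → ℕ → Chain n
move S i k = if k ≡ᵇ i then produced S i else S k

run : {n : ℕ} → Chain n → List ℕ → List (Subset n)
run S []       = []
run S (i ∷ is) = produced S i ∷ run (move S i) is

allSets : (n : ℕ) → List ℕ → List (Subset n)
allSets n seq = map (initChain n) (upTo (suc n)) ++ run (initChain n) seq

IsStepping : ℕ → List ℕ → Set
IsStepping n seq =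
  All (λ i → 1 ≤ i × i ≤ n ∸ 1) seq
  × Unique (allSets n seq)
  × ((s : Subset n) → s LM.∈ allSets n seq)

Contiguous : List ℕ → Set
Contiguous = Linked (λ a b → b ≡ suc a ⊎ a ≡ suc b)

StronglyContiguous : ℕ → List ℕ → Set
StronglyContiguous n seq =
  IsStepping n seq
  × Contiguous seq
  × Σ (List ℕ) (λ rest → seq ≡ (n ∸ 1) ∷ rest)
  × Σ (List ℕ) (λ ini → seq ≡ ini ++ (1 ∷ []))

toInt : {n : ℕ} → Subset n → ℕ
toInt {n} S = sum (toList (tabulate (λ (i : Fin n) → if does (i ∈? S) then 2 ^ toℕ i else 0)))

grayList : (n : ℕ) → List ℕ → List ℕ
grayList n seq = map toInt (allSets n seq)

bit : ℕ → ℕ → ℕ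
bit x zero    = x % 2
bit x (suc k) = bit (x / 2) k

OneBitApart : ℕ → ℕ → Set
OneBitApart a b = Σ ℕ (λ k → bit a k ≢ bit b k × ((j : ℕ) → j ≢ k → bit a j ≡ bit b j))

CyclicGray : List ℕ → Set
CyclicGray []       = ⊤
CyclicGray (x ∷ xs) = Linked OneBitApart ((x ∷ xs) ++ (x ∷ []))

-- R_m  (R_0, R_1 are unused placeholders)
R : ℕ → List ℕ
R 0 = []
R 1 = []
R 2 = 1 ∷ []
R (suc (suc (suc k))) = map suc (R (suc (suc k))) ++ map suc (upTo (suc (suc k))) ++ R (suc (suc k))

-- C = (A+1) ∪ [1, ..., m-1] ∪ B, here with m = suc n
combine : ℕ → List ℕ → List ℕ → List ℕ
combine n A B = map suc A ++ map suc (upTo n) ++ B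

module Submission where

-- Invariant: every chain reached from the initial one is a rank chain,
-- S_k = {j | rank j < k} for a permutation `rank` of the ground set, and a move
-- with index i swaps the ranks i-1 and i (rank-move).  So consecutive members
-- differ in one element (rank-step), and for a strongly contiguous sequence the
-- list S_0, …, S_n, produced sets, S_0 is a walk of single flips (walk,
-- closed-walk); one flipped element is one flipped bit of the binary value
-- (oneFlip⇒oneBitApart), which is the cyclic Gray code.
--
-- For the combination C the listed sets are computed in three phases, each by
-- relating a run on {0, …, n} to a run on {0, …, n-1} (Simulation): A+1 acts
-- like A with 0 added, the moves 1, …, n remove 0 again from the members of the
-- chain F left by A, and B then acts like B pulled back along the ranking of F.
-- Up to a rotation the sets of C are therefore those of A with 0 added followed
-- by the (bijective) pullbacks of those of B without 0, so C is a stepping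
-- sequence; contiguity and the end points are list bookkeeping.  Finally R_m is
-- the combination of R_{m-1} with itself, starting from R_2 = [1].

open import Defs
open import Data.Bool using (Bool; true; false; not; _∧_; _∨_; if_then_else_; T)
open import Data.Bool.Properties using (not-involutive)
open import Data.Empty using (⊥-elim)
open import Data.Unit using (tt)
open import Data.Nat using (ℕ; zero; suc; _+_; _*_; _∸_; _^_; _≤_; _<_; _<ᵇ_; _≡ᵇ_; _/_; z≤n; s≤s)
open import Data.Nat.Properties using (_≟_; m∸n≤m; _<?_; ≮⇒≥; ≤-refl; ≤-trans; n≤1+n; n<1+n; ≡ᵇ⇒≡; ≡⇒≡ᵇ; *-zeroʳ; *-distribˡ-+; *-comm)
open import Data.Nat.DivMod using ([m+kn]%n≡m%n; +-distrib-/-∣ʳ; m*n/n≡m)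
open import Data.Nat.Divisibility using (divides-refl)
open import Data.Nat.ListAction using (sum)
open import Data.Fin using (Fin; zero; suc; toℕ; fromℕ<)
open import Data.Fin.Properties using (toℕ-injective; toℕ-fromℕ<) renaming (_≟_ to _≟ᶠ_)
open import Data.Fin.Permutation using (Permutation′; _⟨$⟩ʳ_; _⟨$⟩ˡ_; inverseˡ; inverseʳ; transpose; _∘ₚ_) renaming (id to idₚ)
import Data.Fin.Permutation.Components as PC
open import Data.Fin.Subset using (Subset; _∪_; _─_)
open import Data.Fin.Subset.Properties using (_∈?_)
open import Data.Vec using ([]; _∷_; tabulate; lookup; toList)
import Data.Vec as Vec
open import Data.Vec.Properties using (tabulate-cong; lookup∘tabulate; tabulate∘lookup; lookup-zipWith; tabulate-∘; toList-map; ∷-injectiveʳ)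
open import Data.List using (List; []; _∷_; _++_; map; last; applyUpTo; upTo)
open import Data.List.Properties using (++-assoc; map-++; map-upTo; map-applyUpTo; applyUpTo-∷ʳ; map-id; map-∘; map-cong; last-map)
open import Data.List.Relation.Unary.All using (All; []; _∷_)
import Data.List.Relation.Unary.All as All
import Data.List.Relation.Unary.All.Properties as All
open import Data.List.Relation.Unary.AllPairs using ([]; _∷_)
open import Data.List.Relation.Unary.Any using (here; there)
open import Data.List.Relation.Unary.Linked using (Linked; [-]; _∷_)
import Data.List.Relation.Unary.Linked as Linked
import Data.List.Relation.Unary.Linked.Properties as Linked
open import Data.List.Relation.Unary.Unique.Propositional using (Unique)
import Data.List.Relation.Unary.Unique.Propositional.Properties as Unique
open import Data.List.Membership.Propositional using (_∈_)
open import Data.List.Membership.Propositional.Properties using (∈-map⁺; ∈-map⁻; ∈-++⁺ˡ; ∈-++⁺ʳ)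
open import Data.List.Relation.Binary.Permutation.Propositional using (_↭_; ↭⇒↭ₛ)
open import Data.List.Relation.Binary.Permutation.Propositional.Properties using (∈-resp-↭; shift)
import Data.List.Relation.Binary.Permutation.Setoid.Properties as PermutationProperties
open import Data.Maybe using (just)
import Data.Maybe as Maybe
open import Data.Maybe.Properties using (just-injective)
open import Data.Maybe.Relation.Binary.Connected using (Connected; just)
open import Data.Product using (_×_; _,_; proj₁; proj₂)
open import Data.Sum using (_⊎_; inj₁; inj₂)
open import Function using (_∘_)
open import Relation.Nullary using (¬_; yes; no; does)
open import Relation.Binary.PropositionalEquality
import Relation.Binary.PropositionalEquality as ≡

move-self : ∀ {n} (S : Chain n) i → move S i i ≡ produced S i
move-self S i with i ≡ᵇ i in e
... | true  = refl
... | false = ⊥-elim (subst T e (≡⇒≡ᵇ i i refl))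

move-other : ∀ {n} (S : Chain n) i k → k ≢ i → move S i k ≡ S k
move-other S i k k≢i with k ≡ᵇ i in e
... | true  = ⊥-elim (k≢i (≡ᵇ⇒≡ k i (subst T (sym e) tt)))
... | false = refl

<ᵇ-true : ∀ {x k} → x < k → (x <ᵇ k) ≡ true
<ᵇ-true {zero}  {suc k} _         = refl
<ᵇ-true {suc x} {suc k} (s≤s x<k) = <ᵇ-true x<k

<ᵇ-false : ∀ {x k} → k ≤ x → (x <ᵇ k) ≡ false
<ᵇ-false {x}     {zero}  _         = refl
<ᵇ-false {suc x} {suc k} (s≤s k≤x) = <ᵇ-false k≤x

<ᵇ-step : ∀ {x k} → x ≢ k → (x <ᵇ k) ≡ (x <ᵇ suc k)
<ᵇ-step {zero}  {zero}  0≢0 = ⊥-elim (0≢0 refl)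
<ᵇ-step {zero}  {suc k} _   = refl
<ᵇ-step {suc x} {zero}  _   = refl
<ᵇ-step {suc x} {suc k} x≢k = <ᵇ-step (λ x≡k → x≢k (cong suc x≡k))

<ᵇ-mono : ∀ x j → ((x <ᵇ j) ∨ ((x <ᵇ suc j) ∧ not (x <ᵇ j))) ≡ (x <ᵇ suc j)
<ᵇ-mono zero    zero    = refl
<ᵇ-mono zero    (suc j) = refl
<ᵇ-mono (suc x) zero    = refl
<ᵇ-mono (suc x) (suc j) = <ᵇ-mono x j

-- The transposition of r and r+1 on ℕ, by recursion so that its interaction
-- with thresholds can be computed by pattern matching.
swapℕ : ℕ → ℕ → ℕ
swapℕ zero    zero          = 1
swapℕ zero    (suc zero)    = 0
swapℕ zero    (suc (suc x)) = suc (suc x)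
swapℕ (suc r) zero          = zero
swapℕ (suc r) (suc x)       = suc (swapℕ r x)

swapℕ-left : ∀ r → swapℕ r r ≡ suc r
swapℕ-left zero    = refl
swapℕ-left (suc r) = cong suc (swapℕ-left r)

swapℕ-right : ∀ r → swapℕ r (suc r) ≡ r
swapℕ-right zero    = refl
swapℕ-right (suc r) = cong suc (swapℕ-right r)

swapℕ-other : ∀ r x → x ≢ r → x ≢ suc r → swapℕ r x ≡ x
swapℕ-other zero    zero          x≢0 _   = ⊥-elim (x≢0 refl)
swapℕ-other zero    (suc zero)    _   x≢1 = ⊥-elim (x≢1 refl)
swapℕ-other zero    (suc (suc x)) _   _   = refl
swapℕ-other (suc r) zero          _   _   = refl
swapℕ-other (suc r) (suc x)       x≢r x≢r' =
  cong suc (swapℕ-other r x (λ e → x≢r (cong suc e)) (λ e → x≢r' (cong suc e)))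

swapℕ-below : ∀ r x k → k ≢ suc r → (swapℕ r x <ᵇ k) ≡ (x <ᵇ k)
swapℕ-below r       x             zero    _ = refl
swapℕ-below zero    zero          (suc zero) k≢1 = ⊥-elim (k≢1 refl)
swapℕ-below zero    zero          (suc (suc k)) _ = refl
swapℕ-below zero    (suc zero)    (suc zero) k≢1 = ⊥-elim (k≢1 refl)
swapℕ-below zero    (suc zero)    (suc (suc k)) _ = refl
swapℕ-below zero    (suc (suc x)) (suc k) _ = refl
swapℕ-below (suc r) zero          (suc k) _ = refl
swapℕ-below (suc r) (suc x)       (suc k) k≢r = swapℕ-below r x k (λ e → k≢r (cong suc e))

swapℕ-produced : ∀ r x → (swapℕ r x <ᵇ suc r) ≡ ((x <ᵇ r) ∨ ((x <ᵇ suc (suc r)) ∧ not (x <ᵇ suc r)))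
swapℕ-produced zero    zero          = refl
swapℕ-produced zero    (suc zero)    = refl
swapℕ-produced zero    (suc (suc x)) = refl
swapℕ-produced (suc r) zero          = refl
swapℕ-produced (suc r) (suc x)       = swapℕ-produced r x

subset-ext : ∀ {n} {p q : Subset n} → (∀ j → lookup p j ≡ lookup q j) → p ≡ q
subset-ext {p = p} {q} p≗q = trans (sym (tabulate∘lookup p)) (trans (tabulate-cong p≗q) (tabulate∘lookup q))

lookup-─ : ∀ {n} (p q : Subset n) j → lookup (p ─ q) j ≡ (lookup p j ∧ not (lookup q j))
lookup-─ (true  ∷ p) (true  ∷ q) zero    = refl
lookup-─ (true  ∷ p) (false ∷ q) zero    = refl
lookup-─ (false ∷ p) (true  ∷ q) zero    = refl
lookup-─ (false ∷ p) (false ∷ q) zero    = refl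
lookup-─ (_     ∷ p) (_     ∷ q) (suc j) = lookup-─ p q j

lookup-produced : ∀ {n} (S : Chain n) i j →
  lookup (produced S i) j ≡ (lookup (S (i ∸ 1)) j ∨ (lookup (S (suc i)) j ∧ not (lookup (S i) j)))
lookup-produced S i j =
  trans (lookup-zipWith _∨_ j (S (i ∸ 1)) _) (cong (lookup (S (i ∸ 1)) j ∨_) (lookup-─ (S (suc i)) (S i) j))

record OneFlip {n : ℕ} (s t : Subset n) : Set where
  constructor flipAt
  field
    position : Fin n
    flipped  : lookup t position ≡ not (lookup s position)
    others   : ∀ j → j ≢ position → lookup s j ≡ lookup t j

oneFlip-sym : ∀ {n} {s t : Subset n} → OneFlip s t → OneFlip t s
oneFlip-sym {s = s} {t} (flipAt v flipped others) =
  flipAt v (trans (sym (not-involutive (lookup s v))) (cong not (sym flipped))) (λ j j≢v → sym (others j j≢v))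

below : ∀ {n} → Permutation′ n → Chain n
below π k = tabulate (λ j → toℕ (π ⟨$⟩ʳ j) <ᵇ k)

record RankChain {n : ℕ} (S : Chain n) : Set where
  field
    rank     : Permutation′ n
    is-below : ∀ k → S k ≡ below rank k

  rankOf : Fin n → ℕ
  rankOf j = toℕ (rank ⟨$⟩ʳ j)

  member : ∀ k j → lookup (S k) j ≡ (rankOf j <ᵇ k)
  member k j = trans (cong (λ s → lookup s j) (is-below k)) (lookup∘tabulate _ j)

open RankChain

initChain-rank : ∀ n → RankChain (initChain n)
initChain-rank n = record { rank = idₚ ; is-below = λ _ → refl }

rank-step : ∀ {n} {S : Chain n} (R : RankChain S) k → k < n → OneFlip (S k) (S (suc k))
rank-step {n} {S} R k k<n = flipAt v flip same
  where
  kᶠ : Fin n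
  kᶠ = fromℕ< k<n
  v : Fin n
  v = rank R ⟨$⟩ˡ kᶠ
  rank-v : rankOf R v ≡ k
  rank-v = trans (cong toℕ (inverseʳ (rank R))) (toℕ-fromℕ< k<n)
  flip : lookup (S (suc k)) v ≡ not (lookup (S k) v)
  flip rewrite member R (suc k) v | member R k v | rank-v
             | <ᵇ-true (n<1+n k) | <ᵇ-false (≤-refl {k}) = refl
  same : ∀ j → j ≢ v → lookup (S k) j ≡ lookup (S (suc k)) j
  same j j≢v = trans (member R k j) (trans (<ᵇ-step rank≢k) (sym (member R (suc k) j)))
    where
    rank≢k : rankOf R j ≢ k
    rank≢k e = j≢v (trans (sym (inverseˡ (rank R))) (cong (rank R ⟨$⟩ˡ_) (toℕ-injective (trans e (sym (toℕ-fromℕ< k<n))))))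

-- Move indices are the i with 1 ≤ i ≤ n-1; for them S_{i+1} is a genuine member.
InRange : ℕ → ℕ → Set
InRange n i = 1 ≤ i × i ≤ n ∸ 1

inRange-bound : ∀ {n i} → InRange n i → suc i ≤ n
inRange-bound {zero}  (1≤i , i≤0) with ≤-trans 1≤i i≤0
... | ()
inRange-bound {suc n} (_ , i≤n) = s≤s i≤n

toℕ-transpose : ∀ {n} (a b y : Fin n) → toℕ b ≡ suc (toℕ a) →
                toℕ (PC.transpose a b y) ≡ swapℕ (toℕ a) (toℕ y)
toℕ-transpose a b y b≡a+1 with y ≟ᶠ a
... | yes refl = trans b≡a+1 (sym (swapℕ-left (toℕ y)))
... | no y≢a with y ≟ᶠ b
...   | yes refl = sym (trans (cong (swapℕ (toℕ a)) b≡a+1) (swapℕ-right (toℕ a)))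
...   | no y≢b = sym (swapℕ-other (toℕ a) (toℕ y) (λ e → y≢a (toℕ-injective e))
                                   (λ e → y≢b (toℕ-injective (trans e (sym b≡a+1)))))

-- A move with index i transposes the ranks i-1 and i, so rank chains stay rank chains.
rank-move : ∀ {n} {S : Chain n} → RankChain S → ∀ i → InRange n i → RankChain (move S i)
rank-move {n} {S} R zero (() , _)
rank-move {n} {S} R (suc r) inRange = record { rank = rank′ ; is-below = is-below′ }
  where
  r+2≤n : suc (suc r) ≤ n
  r+2≤n = inRange-bound inRange
  rank′ : Permutation′ n
  rank′ = rank R ∘ₚ transpose (fromℕ< (≤-trans (n≤1+n _) r+2≤n)) (fromℕ< r+2≤n)
  rank′-swaps : ∀ j → toℕ (rank′ ⟨$⟩ʳ j) ≡ swapℕ r (rankOf R j)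
  rank′-swaps j = trans (toℕ-transpose _ _ _ (trans (toℕ-fromℕ< r+2≤n) (cong suc (sym (toℕ-fromℕ< _)))))
                        (cong (λ a → swapℕ a (rankOf R j)) (toℕ-fromℕ< _))
  is-below′ : ∀ k → move S (suc r) k ≡ below rank′ k
  is-below′ k with k ≟ suc r
  ... | yes refl = trans (move-self S (suc r)) (subset-ext λ j → begin
        lookup (produced S (suc r)) j
          ≡⟨ lookup-produced S (suc r) j ⟩
        (lookup (S r) j ∨ (lookup (S (suc (suc r))) j ∧ not (lookup (S (suc r)) j)))
          ≡⟨ cong₂ (λ p q → p ∨ (q ∧ not (lookup (S (suc r)) j))) (member R r j) (member R (suc (suc r)) j) ⟩
        ((rankOf R j <ᵇ r) ∨ ((rankOf R j <ᵇ suc (suc r)) ∧ not (lookup (S (suc r)) j)))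
          ≡⟨ cong (λ p → (rankOf R j <ᵇ r) ∨ ((rankOf R j <ᵇ suc (suc r)) ∧ not p)) (member R (suc r) j) ⟩
        ((rankOf R j <ᵇ r) ∨ ((rankOf R j <ᵇ suc (suc r)) ∧ not (rankOf R j <ᵇ suc r)))
          ≡⟨ sym (swapℕ-produced r (rankOf R j)) ⟩
        (swapℕ r (rankOf R j) <ᵇ suc r)
          ≡⟨ cong (_<ᵇ suc r) (sym (rank′-swaps j)) ⟩
        (toℕ (rank′ ⟨$⟩ʳ j) <ᵇ suc r)
          ≡⟨ sym (lookup∘tabulate _ j) ⟩
        lookup (below rank′ (suc r)) j ∎)
    where open ≡-Reasoning
  ... | no k≢i = trans (move-other S (suc r) k k≢i) (subset-ext λ j →
        trans (member R k j) (trans (sym (swapℕ-below r (rankOf R j) k k≢i))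
              (trans (cong (_<ᵇ k) (sym (rank′-swaps j))) (sym (lookup∘tabulate _ j)))))

bitValue : Bool → ℕ
bitValue true  = 1
bitValue false = 0

bitValue-not : ∀ b → bitValue (not b) ≢ bitValue b
bitValue-not true  ()
bitValue-not false ()

sum-map-* : ∀ k xs → sum (map (k *_) xs) ≡ k * sum xs
sum-map-* k []       = sym (*-zeroʳ k)
sum-map-* k (x ∷ xs) = trans (cong (k * x +_) (sum-map-* k xs)) (sym (*-distribˡ-+ k x (sum xs)))

toInt-∷ : ∀ {n} b (s : Subset n) → toInt (b ∷ s) ≡ bitValue b + toInt s * 2
toInt-∷ {n} b s = cong₂ _+_ (value-of-0 b) (begin
    sum (toList (tabulate (λ i → if does (i ∈? s) then 2 * 2 ^ toℕ i else 0)))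
      ≡⟨ cong (sum ∘ toList) (tabulate-cong (λ i → double-if (does (i ∈? s)) (2 ^ toℕ i))) ⟩
    sum (toList (tabulate ((2 *_) ∘ term)))
      ≡⟨ cong (sum ∘ toList) (tabulate-∘ (2 *_) term) ⟩
    sum (toList (Vec.map (2 *_) (tabulate term)))
      ≡⟨ cong sum (toList-map (2 *_) (tabulate term)) ⟩
    sum (map (2 *_) (toList (tabulate term)))
      ≡⟨ sum-map-* 2 (toList (tabulate term)) ⟩
    2 * toInt s
      ≡⟨ *-comm 2 (toInt s) ⟩
    toInt s * 2 ∎)
  where
  open ≡-Reasoning
  term : Fin n → ℕ
  term i = if does (i ∈? s) then 2 ^ toℕ i else 0
  value-of-0 : ∀ b → (if does (zero ∈? (b ∷ s)) then 1 else 0) ≡ bitValue b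
  value-of-0 true  = refl
  value-of-0 false = refl
  double-if : ∀ (d : Bool) x → (if d then 2 * x else 0) ≡ 2 * (if d then x else 0)
  double-if true  x = refl
  double-if false x = refl

bit-zero : ∀ k → bit 0 k ≡ 0
bit-zero zero    = refl
bit-zero (suc k) = bit-zero k

bit-head : ∀ b t → bit (bitValue b + t * 2) 0 ≡ bitValue b
bit-head true  t = [m+kn]%n≡m%n 1 t 2
bit-head false t = [m+kn]%n≡m%n 0 t 2

bit-tail : ∀ b t k → bit (bitValue b + t * 2) (suc k) ≡ bit t k
bit-tail b t k = cong (λ x → bit x k) (halve b)
  where
  halve : ∀ b → (bitValue b + t * 2) / 2 ≡ t
  halve true  = trans (+-distrib-/-∣ʳ 1 {t * 2} {2} (divides-refl t)) (m*n/n≡m t 2)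
  halve false = trans (+-distrib-/-∣ʳ 0 {t * 2} {2} (divides-refl t)) (m*n/n≡m t 2)

bit-toInt : ∀ {n} (s : Subset n) j → bit (toInt s) (toℕ j) ≡ bitValue (lookup s j)
bit-toInt (b ∷ s) zero    = trans (cong (λ x → bit x 0) (toInt-∷ b s)) (bit-head b (toInt s))
bit-toInt (b ∷ s) (suc j) =
  trans (cong (λ x → bit x (suc (toℕ j))) (toInt-∷ b s)) (trans (bit-tail b (toInt s) (toℕ j)) (bit-toInt s j))

bit-toInt-high : ∀ {n} (s : Subset n) k → n ≤ k → bit (toInt s) k ≡ 0
bit-toInt-high []      k       _         = bit-zero k
bit-toInt-high (b ∷ s) (suc k) (s≤s n≤k) =
  trans (cong (λ x → bit x (suc k)) (toInt-∷ b s)) (trans (bit-tail b (toInt s) k) (bit-toInt-high s k n≤k))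

oneFlip⇒oneBitApart : ∀ {n} {s t : Subset n} → OneFlip s t → OneBitApart (toInt s) (toInt t)
oneFlip⇒oneBitApart {n} {s} {t} (flipAt v flip same) = toℕ v , bit-v-differs , other-bits-agree
  where
  bit-v-differs : bit (toInt s) (toℕ v) ≢ bit (toInt t) (toℕ v)
  bit-v-differs e = bitValue-not (lookup s v) (begin
    bitValue (not (lookup s v)) ≡⟨ cong bitValue (sym flip) ⟩
    bitValue (lookup t v)       ≡⟨ sym (bit-toInt t v) ⟩
    bit (toInt t) (toℕ v)       ≡⟨ sym e ⟩
    bit (toInt s) (toℕ v)       ≡⟨ bit-toInt s v ⟩
    bitValue (lookup s v)       ∎)
    where open ≡-Reasoning
  other-bits-agree : ∀ k → k ≢ toℕ v → bit (toInt s) k ≡ bit (toInt t) k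
  other-bits-agree k k≢v with k <? n
  ... | no k≮n = trans (bit-toInt-high s k (≮⇒≥ k≮n)) (sym (bit-toInt-high t k (≮⇒≥ k≮n)))
  ... | yes k<n = subst (λ k → bit (toInt s) k ≡ bit (toInt t) k) (toℕ-fromℕ< k<n)
        (trans (bit-toInt s kᶠ) (trans (cong bitValue (same kᶠ kᶠ≢v)) (sym (bit-toInt t kᶠ))))
    where
    kᶠ : Fin n
    kᶠ = fromℕ< k<n
    kᶠ≢v : kᶠ ≢ v
    kᶠ≢v e = k≢v (trans (sym (toℕ-fromℕ< k<n)) (cong toℕ e))

Adjacent : ℕ → ℕ → Set
Adjacent a b = b ≡ suc a ⊎ a ≡ suc b

adjacent-≢ : ∀ {a b} → Adjacent a b → a ≢ b
adjacent-≢ (inj₁ refl) ()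
adjacent-≢ (inj₂ refl) ()

rank-adjacent : ∀ {n} {S : Chain n} → RankChain S → ∀ {p i} → Adjacent p i → i < n → OneFlip (S p) (S i)
rank-adjacent R (inj₁ refl) i<n = rank-step R _ (≤-trans (n≤1+n _) i<n)
rank-adjacent R (inj₂ refl) i<n = oneFlip-sym (rank-step R _ i<n)

last-∷ʳ : ∀ {A : Set} (xs : List A) x → last (xs ++ x ∷ []) ≡ just x
last-∷ʳ []           x = refl
last-∷ʳ (_ ∷ [])     x = refl
last-∷ʳ (_ ∷ y ∷ ys) x = last-∷ʳ (y ∷ ys) x

-- If the previous move had index p
-- adjacent to i, the set produced by move i (the new S_i) differs in one
-- element from S_p, which that move left untouched.  Moves never touch S_0,
-- and a final move with index 1 produces a set adjacent to S_0.
walk : ∀ {n} {S : Chain n} → RankChain S → ∀ {p} i rest → Adjacent p i →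
       All (InRange n) (i ∷ rest) → Contiguous (i ∷ rest) → last (i ∷ rest) ≡ just 1 →
       Linked OneFlip (S p ∷ run S (i ∷ rest) ++ S 0 ∷ [])
walk R zero _ _ ((() , _) ∷ _) _ _
walk {n} {S} R {p} i@(suc r) rest p~i (i-ok ∷ rest-ok) contiguous ends = first ∷ continue rest contiguous rest-ok ends
  where
  S′ : Chain n
  S′ = move S i
  R′ : RankChain S′
  R′ = rank-move R i i-ok
  i<n : i < n
  i<n = inRange-bound i-ok
  first : OneFlip (S p) (produced S i)
  first = subst₂ OneFlip (move-other S i p (adjacent-≢ p~i)) (move-self S i) (rank-adjacent R′ p~i i<n)
  continue : ∀ rest → Contiguous (i ∷ rest) → All (InRange n) rest → last (i ∷ rest) ≡ just 1 →
             Linked OneFlip (produced S i ∷ run S′ rest ++ S 0 ∷ [])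
  continue [] _ _ ends with just-injective ends
  ... | refl = subst (λ s → OneFlip s (S 0)) (move-self S 1) (oneFlip-sym (rank-step R′ 0 (≤-trans (s≤s z≤n) i<n))) ∷ [-]
  continue (j ∷ rest) (i~j ∷ contiguous) rest-ok ends =
    subst (λ s → Linked OneFlip (s ∷ run S′ (j ∷ rest) ++ S 0 ∷ [])) (move-self S i)
          (walk R′ j rest i~j rest-ok contiguous ends)

applyUpTo-linked : ∀ {A : Set} {R : A → A → Set} (f : ℕ → A) m ys →
                   (∀ t → t < m → R (f t) (f (suc t))) → Linked R (f m ∷ ys) →
                   Linked R (applyUpTo f (suc m) ++ ys)
applyUpTo-linked f zero    ys _     linked = linked
applyUpTo-linked f (suc m) ys steps linked =
  steps 0 (s≤s z≤n) ∷ applyUpTo-linked (f ∘ suc) m ys (λ t t<m → steps (suc t) (s≤s t<m)) linked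

-- For a strongly contiguous sequence, the list of all sets closed up by S_0
-- is a walk of single flips: first S_0, …, S_n, then the walk from S_n.
closed-walk : ∀ n seq → StronglyContiguous n seq → Linked OneFlip (allSets n seq ++ initChain n 0 ∷ [])
closed-walk zero    _ (((() , _) ∷ _ , _) , _ , (_ , refl) , _)
closed-walk (suc m) seq ((in-range , _) , contiguous , (rest , refl) , (ini , ends-with-1)) =
  subst (Linked OneFlip) (sym (begin
    (map I (upTo (suc (suc m))) ++ run I seq) ++ I 0 ∷ []
      ≡⟨ ++-assoc (map I (upTo (suc (suc m)))) (run I seq) (I 0 ∷ []) ⟩
    map I (upTo (suc (suc m))) ++ run I seq ++ I 0 ∷ []
      ≡⟨ cong (_++ run I seq ++ I 0 ∷ []) (map-upTo I (suc (suc m))) ⟩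
    applyUpTo I (suc (suc m)) ++ run I seq ++ I 0 ∷ [] ∎))
  (applyUpTo-linked I (suc m) _ (rank-step (initChain-rank (suc m)))
    (walk (initChain-rank (suc m)) m rest (inj₂ refl) in-range contiguous
          (subst (λ l → last l ≡ just 1) (sym ends-with-1) (last-∷ʳ ini 1))))
  where
  open ≡-Reasoning
  I : Chain (suc m)
  I = initChain (suc m)

stronglyContiguous⇒cyclicGray : ∀ n seq → StronglyContiguous n seq → CyclicGray (grayList n seq)
stronglyContiguous⇒cyclicGray n seq sc =
  subst (Linked OneBitApart) (map-++ toInt (allSets n seq) (initChain n 0 ∷ []))
        (Linked.map⁺ (Linked.map oneFlip⇒oneBitApart (closed-walk n seq sc)))

final : ∀ {n} → Chain n → List ℕ → Chain n
final S []       = S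
final S (i ∷ is) = final (move S i) is

run-++ : ∀ {n} (S : Chain n) xs ys → run S (xs ++ ys) ≡ run S xs ++ run (final S xs) ys
run-++ S []       ys = refl
run-++ S (x ∷ xs) ys = cong (produced S x ∷_) (run-++ (move S x) xs ys)

final-∷ʳ : ∀ {n} (S : Chain n) xs x → final S (xs ++ x ∷ []) ≡ move (final S xs) x
final-∷ʳ S []       x = refl
final-∷ʳ S (y ∷ xs) x = final-∷ʳ (move S y) xs x

rank-final : ∀ {n} {S : Chain n} → RankChain S → ∀ xs → All (InRange n) xs → RankChain (final S xs)
rank-final R []       []            = R
rank-final R (i ∷ xs) (i-ok ∷ xs-ok) = rank-final (rank-move R i i-ok) xs xs-ok

-- Chains agreeing on their members S_0, …, S_N (the only ones a move with
-- index below N can read).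
Agree : ∀ {m} → ℕ → Chain m → Chain m → Set
Agree N T T′ = ∀ k → k ≤ N → T k ≡ T′ k

agree-move : ∀ {m} {N} (T T′ : Chain m) j → T′ j ≡ produced T j →
             (∀ k → k ≤ N → k ≢ j → T k ≡ T′ k) → Agree N (move T j) T′
agree-move T T′ j at-j elsewhere k k≤N with k ≟ j
... | yes refl = trans (move-self T j) (sym at-j)
... | no k≢j   = trans (move-other T j k k≢j) (elsewhere k k≤N k≢j)

-- A simulation of moves on n-element sets by moves on m-element sets: while
-- T agrees with the image E S of a chain, the move g i on T produces the image
-- φ of the set produced by i on S, and afterwards T again agrees with the image.
record Simulation {n m : ℕ} (N : ℕ) (E : Chain n → Chain m) (φ : Subset n → Subset m) (g : ℕ → ℕ) : Set where
  field
    sim-produced : ∀ S T i → InRange n i → Agree N T (E S) → produced T (g i) ≡ φ (produced S i)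
    sim-move     : ∀ S T i → InRange n i → Agree N T (E S) → Agree N (move T (g i)) (E (move S i))

simulate : ∀ {n m N E φ g} → Simulation {n} {m} N E φ g → ∀ S T xs → Agree N T (E S) → All (InRange n) xs →
           run T (map g xs) ≡ map φ (run S xs) × Agree N (final T (map g xs)) (E (final S xs))
simulate sim S T []       agree []             = refl , agree
simulate {n} {m} {N} {E} {φ} {g} sim S T (i ∷ xs) agree (i-ok ∷ xs-ok) =
  cong₂ _∷_ (sim-produced S T i i-ok agree) (proj₁ rest) , proj₂ rest
  where
  open Simulation sim
  rest : run (move T (g i)) (map g xs) ≡ map φ (run (move S i) xs)
         × Agree N (final (move T (g i)) (map g xs)) (E (final (move S i) xs))
  rest = simulate sim (move S i) (move T (g i)) xs (sim-move S T i i-ok agree) xs-ok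

-- Phase A+1.  The chain on {0, …, n} whose members are ∅ followed by
-- {0} ∪ (S_k shifted up by one); on it the moves A+1 act like A.
lift : ∀ {n} → Chain n → Chain (suc n)
lift S zero    = false ∷ S 0
lift S (suc k) = true ∷ S k

lift-simulation : ∀ n → Simulation (suc n) (lift {n}) (true ∷_) suc
lift-simulation n = record { sim-produced = lift-produced ; sim-move = lift-move }
  where
  lift-produced : ∀ S T i → InRange n i → Agree (suc n) T (lift S) → produced T (suc i) ≡ true ∷ produced S i
  lift-produced S T zero    (() , _) _
  lift-produced S T (suc r) i-ok agree =
    cong₂ _∪_ (agree (suc r) (≤-trans (n≤1+n _) r+2≤n+1))
              (cong₂ _─_ (agree (suc (suc (suc r))) (s≤s r+2≤n)) (agree (suc (suc r)) r+2≤n+1))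
    where
    r+2≤n : suc (suc r) ≤ n
    r+2≤n = inRange-bound i-ok
    r+2≤n+1 : suc (suc r) ≤ suc n
    r+2≤n+1 = ≤-trans r+2≤n (n≤1+n n)
  lift-move : ∀ S T i → InRange n i → Agree (suc n) T (lift S) → Agree (suc n) (move T (suc i)) (lift (move S i))
  lift-move S T zero    (() , _) _
  lift-move S T (suc r) i-ok agree = agree-move T (lift (move S (suc r))) (suc (suc r))
    (trans (cong (true ∷_) (move-self S (suc r))) (sym (lift-produced S T (suc r) i-ok agree)))
    elsewhere
    where
    elsewhere : ∀ k → k ≤ suc n → k ≢ suc (suc r) → T k ≡ lift (move S (suc r)) k
    elsewhere zero    k≤N _   = agree zero k≤N
    elsewhere (suc k) k≤N k≢i = trans (agree (suc k) k≤N) (cong (true ∷_) (sym (move-other S (suc r) k (k≢i ∘ cong suc))))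

-- Phase [1, …, n].  midChain F j is the lift of F after the moves 1, …, j-1:
-- its members below j have lost the element 0 again.
midChain : ∀ {n} → Chain n → ℕ → Chain (suc n)
midChain F j k = if k <ᵇ j then false ∷ F k else true ∷ F (k ∸ 1)

lift-is-mid : ∀ {n} (F : Chain n) k → lift F k ≡ midChain F 1 k
lift-is-mid F zero    = refl
lift-is-mid F (suc k) = refl

mid-below : ∀ {n} (F : Chain n) {j k} → k < j → midChain F j k ≡ false ∷ F k
mid-below F k<j rewrite <ᵇ-true k<j = refl

mid-above : ∀ {n} (F : Chain n) {j k} → j ≤ k → midChain F j k ≡ true ∷ F (k ∸ 1)
mid-above F j≤k rewrite <ᵇ-false j≤k = refl

mid-other : ∀ {n} (F : Chain n) {j k} → k ≢ j → midChain F j k ≡ midChain F (suc j) k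
mid-other F k≢j rewrite <ᵇ-step k≢j = refl

Increasing : ∀ {n} → Chain n → Set
Increasing F = ∀ j → F j ∪ (F (suc j) ─ F j) ≡ F (suc j)

rank-increasing : ∀ {n} {F : Chain n} → RankChain F → Increasing F
rank-increasing {F = F} R j = subset-ext λ x → begin
  lookup (F j ∪ (F (suc j) ─ F j)) x
    ≡⟨ lookup-zipWith _∨_ x (F j) _ ⟩
  (lookup (F j) x ∨ lookup (F (suc j) ─ F j) x)
    ≡⟨ cong (lookup (F j) x ∨_) (lookup-─ (F (suc j)) (F j) x) ⟩
  (lookup (F j) x ∨ (lookup (F (suc j)) x ∧ not (lookup (F j) x)))
    ≡⟨ cong₂ (λ p q → p ∨ (q ∧ not p)) (member R j x) (member R (suc j) x) ⟩
  ((rankOf R x <ᵇ j) ∨ ((rankOf R x <ᵇ suc j) ∧ not (rankOf R x <ᵇ j)))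
    ≡⟨ <ᵇ-mono (rankOf R x) j ⟩
  (rankOf R x <ᵇ suc j)
    ≡⟨ sym (member R (suc j) x) ⟩
  lookup (F (suc j)) x ∎
  where open ≡-Reasoning

mid-step : ∀ {n} {F : Chain n} → Increasing F → ∀ c (T : Chain (suc n)) → suc c ≤ n →
           Agree (suc n) T (midChain F (suc c)) →
           produced T (suc c) ≡ false ∷ F (suc c) × Agree (suc n) (move T (suc c)) (midChain F (suc (suc c)))
mid-step {n} {F} increasing c T c<n agree = produces , agree-move T _ (suc c) (trans (mid-below F ≤-refl) (sym produces)) elsewhere
  where
  c+1≤n+1 : suc c ≤ suc n
  c+1≤n+1 = ≤-trans c<n (n≤1+n n)
  produces : produced T (suc c) ≡ false ∷ F (suc c)
  produces = begin
    T c ∪ (T (suc (suc c)) ─ T (suc c))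
      ≡⟨ cong₂ _∪_ (trans (agree c (≤-trans (n≤1+n c) c+1≤n+1)) (mid-below F ≤-refl))
                   (cong₂ _─_ (trans (agree (suc (suc c)) (s≤s c<n)) (mid-above F (n≤1+n _)))
                              (trans (agree (suc c) c+1≤n+1) (mid-above F ≤-refl))) ⟩
    false ∷ (F c ∪ (F (suc c) ─ F c))
      ≡⟨ cong (false ∷_) (increasing c) ⟩
    false ∷ F (suc c) ∎
    where open ≡-Reasoning
  elsewhere : ∀ k → k ≤ suc n → k ≢ suc c → T k ≡ midChain F (suc (suc c)) k
  elsewhere k k≤N k≢c+1 = trans (agree k k≤N) (mid-other F k≢c+1)

mid-run : ∀ {n} {F : Chain n} → Increasing F → ∀ c (T : Chain (suc n)) → c ≤ n →
          Agree (suc n) T (midChain F 1) →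
          run T (applyUpTo suc c) ≡ map (λ k → false ∷ F k) (applyUpTo suc c)
          × Agree (suc n) (final T (applyUpTo suc c)) (midChain F (suc c))
mid-run increasing zero    T _   agree = refl , agree
mid-run {n} {F} increasing (suc c) T c<n agree =
  subst Reaches (applyUpTo-∷ʳ suc c) (produces , ends-at)
  where
  moves : List ℕ
  moves = applyUpTo suc c
  Reaches : List ℕ → Set
  Reaches xs = run T xs ≡ map (λ k → false ∷ F k) xs × Agree (suc n) (final T xs) (midChain F (suc (suc c)))
  first-c : run T moves ≡ map (λ k → false ∷ F k) moves × Agree (suc n) (final T moves) (midChain F (suc c))
  first-c = mid-run increasing c T (≤-trans (n≤1+n c) c<n) agree
  last-move : produced (final T moves) (suc c) ≡ false ∷ F (suc c)
              × Agree (suc n) (move (final T moves) (suc c)) (midChain F (suc (suc c)))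
  last-move = mid-step increasing c (final T moves) c<n (proj₂ first-c)
  produces : run T (moves ++ suc c ∷ []) ≡ map (λ k → false ∷ F k) (moves ++ suc c ∷ [])
  produces = begin
    run T (moves ++ suc c ∷ [])
      ≡⟨ run-++ T moves (suc c ∷ []) ⟩
    run T moves ++ produced (final T moves) (suc c) ∷ []
      ≡⟨ cong₂ (λ xs x → xs ++ x ∷ []) (proj₁ first-c) (proj₁ last-move) ⟩
    map (λ k → false ∷ F k) moves ++ (false ∷ F (suc c)) ∷ []
      ≡⟨ sym (map-++ (λ k → false ∷ F k) moves (suc c ∷ [])) ⟩
    map (λ k → false ∷ F k) (moves ++ suc c ∷ []) ∎
    where open ≡-Reasoning
  ends-at : Agree (suc n) (final T (moves ++ suc c ∷ [])) (midChain F (suc (suc c)))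
  ends-at = subst (λ S → Agree (suc n) S (midChain F (suc (suc c)))) (sym (final-∷ʳ T moves (suc c))) (proj₂ last-move)

preimage : ∀ {n} → (Fin n → Fin n) → Subset n → Subset n
preimage f s = tabulate (lookup s ∘ f)

lookup-preimage : ∀ {n} (f : Fin n → Fin n) s j → lookup (preimage f s) j ≡ lookup s (f j)
lookup-preimage f s j = lookup∘tabulate (lookup s ∘ f) j

preimage-produced : ∀ {n} (f : Fin n → Fin n) (S : Chain n) i →
                    produced (preimage f ∘ S) i ≡ preimage f (produced S i)
preimage-produced f S i = subset-ext λ j → begin
  lookup (produced (preimage f ∘ S) i) j
    ≡⟨ lookup-produced (preimage f ∘ S) i j ⟩
  (lookup (preimage f (S (i ∸ 1))) j ∨ (lookup (preimage f (S (suc i))) j ∧ not (lookup (preimage f (S i)) j)))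
    ≡⟨ cong₂ (λ p q → p ∨ q) (lookup-preimage f (S (i ∸ 1)) j)
             (cong₂ (λ p q → p ∧ not q) (lookup-preimage f (S (suc i)) j) (lookup-preimage f (S i) j)) ⟩
  (lookup (S (i ∸ 1)) (f j) ∨ (lookup (S (suc i)) (f j) ∧ not (lookup (S i) (f j))))
    ≡⟨ sym (lookup-produced S i (f j)) ⟩
  lookup (produced S i) (f j)
    ≡⟨ sym (lookup-preimage f (produced S i) j) ⟩
  lookup (preimage f (produced S i)) j ∎
  where open ≡-Reasoning

preimage-inverse : ∀ {n} (f g : Fin n → Fin n) → (∀ j → f (g j) ≡ j) → ∀ s → preimage g (preimage f s) ≡ s
preimage-inverse f g fg s = subset-ext λ j →
  trans (lookup-preimage g (preimage f s) j) (trans (lookup-preimage f s (g j)) (cong (lookup s) (fg j)))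

preimage-initChain : ∀ {n} (π : Permutation′ n) k → preimage (π ⟨$⟩ʳ_) (initChain n k) ≡ below π k
preimage-initChain π k = tabulate-cong λ j → lookup∘tabulate _ (π ⟨$⟩ʳ j)

pullback-simulation : ∀ n (f : Fin n → Fin n) →
  Simulation n (λ S k → false ∷ preimage f (S k)) (λ s → false ∷ preimage f s) (λ i → i)
pullback-simulation n f = record { sim-produced = pullback-produced ; sim-move = pullback-move }
  where
  E : Chain n → Chain (suc n)
  E S k = false ∷ preimage f (S k)
  pullback-produced : ∀ S T i → InRange n i → Agree n T (E S) → produced T i ≡ false ∷ preimage f (produced S i)
  pullback-produced S T i i-ok agree =
    trans (cong₂ _∪_ (agree (i ∸ 1) (≤-trans (m∸n≤m i 1) i≤n))
                     (cong₂ _─_ (agree (suc i) (inRange-bound i-ok)) (agree i i≤n)))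
          (cong (false ∷_) (preimage-produced f S i))
    where
    i≤n : i ≤ n
    i≤n = ≤-trans (n≤1+n i) (inRange-bound i-ok)
  pullback-move : ∀ S T i → InRange n i → Agree n T (E S) → Agree n (move T i) (E (move S i))
  pullback-move S T i i-ok agree = agree-move T (E (move S i)) i
    (trans (cong (λ s → false ∷ preimage f s) (move-self S i)) (sym (pullback-produced S T i i-ok agree)))
    (λ k k≤n k≢i → trans (agree k k≤n) (cong (λ s → false ∷ preimage f s) (sym (move-other S i k k≢i))))

Complete : ∀ {n} → List (Subset n) → Set
Complete {n} xs = (s : Subset n) → s ∈ xs

unique-↭ : ∀ {n} {xs ys : List (Subset n)} → xs ↭ ys → Unique xs → Unique ys
unique-↭ xs↭ys = PermutationProperties.Unique-resp-↭ (≡.setoid _) (↭⇒↭ₛ xs↭ys)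

complete-↭ : ∀ {n} {xs ys : List (Subset n)} → xs ↭ ys → Complete xs → Complete ys
complete-↭ xs↭ys complete s = ∈-resp-↭ xs↭ys (complete s)

map-unique : ∀ {n} (f g : Subset n → Subset n) → (∀ s → g (f s) ≡ s) →
             ∀ {xs} → Unique xs → Unique (map f xs)
map-unique f g gf = Unique.map⁺ (λ {s} {t} fs≡ft → trans (sym (gf s)) (trans (cong g fs≡ft) (gf t)))

map-complete : ∀ {n} (f g : Subset n → Subset n) → (∀ s → f (g s) ≡ s) →
               ∀ {xs} → Complete xs → Complete (map f xs)
map-complete f g fg {xs} complete s = subst (_∈ map f xs) (fg s) (∈-map⁺ f (complete (g s)))

split-unique : ∀ {n} {xs ys : List (Subset n)} → Unique xs → Unique ys →
               Unique (map (true ∷_) xs ++ map (false ∷_) ys)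
split-unique unique-xs unique-ys =
  Unique.++⁺ (Unique.map⁺ ∷-injectiveʳ unique-xs) (Unique.map⁺ ∷-injectiveʳ unique-ys) disjoint
  where
  disjoint : ∀ {v} → ¬ (v ∈ map (true ∷_) _ × v ∈ map (false ∷_) _)
  disjoint (v∈xs , v∈ys) with ∈-map⁻ (true ∷_) v∈xs | ∈-map⁻ (false ∷_) v∈ys
  ... | _ , _ , refl | _ , _ , ()

split-complete : ∀ {n} {xs ys : List (Subset n)} → Complete xs → Complete ys →
                 Complete (map (true ∷_) xs ++ map (false ∷_) ys)
split-complete complete-xs complete-ys (true  ∷ s) = ∈-++⁺ˡ (∈-map⁺ (true ∷_) (complete-xs s))
split-complete complete-xs complete-ys (false ∷ s) = ∈-++⁺ʳ _ (∈-map⁺ (false ∷_) (complete-ys s))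

-- With F the
-- chain left by A (ranked by π), they are ∅, then {0} ∪ (the sets of A shifted up),
-- then F_1, …, F_n shifted up, then the shifted pullbacks along π of the sets
-- produced by B.
module Combination {n : ℕ} (A B : List ℕ) (A-ok : All (InRange n) A) (B-ok : All (InRange n) B) where

  I : Chain n
  I = initChain n
  I′ : Chain (suc n)
  I′ = initChain (suc n)

  F : Chain n
  F = final I A
  RF : RankChain F
  RF = rank-final (initChain-rank n) A A-ok
  π : Permutation′ n
  π = rank RF

  pull pull⁻¹ : Subset n → Subset n
  pull   = preimage (π ⟨$⟩ʳ_)
  pull⁻¹ = preimage (π ⟨$⟩ˡ_)

  pull-initial : ∀ k → pull (I k) ≡ F k
  pull-initial k = trans (preimage-initChain π k) (sym (is-below RF k))

  -- The initial chain on {0, …, n} is the lift of the initial chain on {0, …, n-1}.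
  T₁ : Chain (suc n)
  T₁ = final I′ (map suc A)
  phase-A : run I′ (map suc A) ≡ map (true ∷_) (run I A) × Agree (suc n) T₁ (lift F)
  phase-A = simulate (lift-simulation n) I I′ A (λ { zero _ → refl ; (suc k) _ → refl }) A-ok

  T₂ : Chain (suc n)
  T₂ = final T₁ (applyUpTo suc n)
  phase-mid : run T₁ (applyUpTo suc n) ≡ map (λ k → false ∷ F k) (applyUpTo suc n)
              × Agree (suc n) T₂ (midChain F (suc n))
  phase-mid = mid-run (rank-increasing RF) n T₁ ≤-refl (λ k k≤ → trans (proj₂ phase-A k k≤) (lift-is-mid F k))

  phase-B : run T₂ (map (λ i → i) B) ≡ map (λ s → false ∷ pull s) (run I B)
            × Agree n (final T₂ (map (λ i → i) B)) (λ k → false ∷ pull (final I B k))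
  phase-B = simulate (pullback-simulation n (π ⟨$⟩ʳ_)) I T₂ B T₂-agrees B-ok
    where
    T₂-agrees : Agree n T₂ (λ k → false ∷ pull (I k))
    T₂-agrees k k≤n = trans (proj₂ phase-mid k (≤-trans k≤n (n≤1+n n)))
                      (trans (mid-below F (s≤s k≤n)) (cong (false ∷_) (sym (pull-initial k))))

  -- Everything after ∅ and the sets containing 0.
  Rest : List (Subset (suc n))
  Rest = map (λ k → false ∷ F k) (applyUpTo suc n) ++ map (λ s → false ∷ pull s) (run I B)

  run-combine : run I′ (combine n A B) ≡ map (true ∷_) (run I A) ++ Rest
  run-combine = begin
    run I′ (map suc A ++ map suc (upTo n) ++ B)
      ≡⟨ cong (λ mid → run I′ (map suc A ++ mid ++ B)) (map-upTo suc n) ⟩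
    run I′ (map suc A ++ applyUpTo suc n ++ B)
      ≡⟨ run-++ I′ (map suc A) _ ⟩
    run I′ (map suc A) ++ run T₁ (applyUpTo suc n ++ B)
      ≡⟨ cong (run I′ (map suc A) ++_) (run-++ T₁ (applyUpTo suc n) B) ⟩
    run I′ (map suc A) ++ run T₁ (applyUpTo suc n) ++ run T₂ B
      ≡⟨ cong₂ _++_ (proj₁ phase-A) (cong₂ _++_ (proj₁ phase-mid) (trans (cong (run T₂) (sym (map-id B))) (proj₁ phase-B))) ⟩
    map (true ∷_) (run I A) ++ Rest ∎
    where open ≡-Reasoning

  allSets-combine : allSets (suc n) (combine n A B) ≡ (false ∷ I 0) ∷ (map (true ∷_) (allSets n A) ++ Rest)
  allSets-combine = cong ((false ∷ I 0) ∷_) (begin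
    map I′ (applyUpTo suc (suc n)) ++ run I′ (combine n A B)
      ≡⟨ cong₂ _++_ initial-part run-combine ⟩
    map (true ∷_) (map I (upTo (suc n))) ++ map (true ∷_) (run I A) ++ Rest
      ≡⟨ sym (++-assoc (map (true ∷_) (map I (upTo (suc n)))) _ Rest) ⟩
    (map (true ∷_) (map I (upTo (suc n))) ++ map (true ∷_) (run I A)) ++ Rest
      ≡⟨ cong (_++ Rest) (sym (map-++ (true ∷_) (map I (upTo (suc n))) (run I A))) ⟩
    map (true ∷_) (allSets n A) ++ Rest ∎)
    where
    open ≡-Reasoning
    initial-part : map I′ (applyUpTo suc (suc n)) ≡ map (true ∷_) (map I (upTo (suc n)))
    initial-part = trans (map-applyUpTo suc I′ (suc n))
                   (sym (trans (cong (map (true ∷_)) (map-upTo I (suc n))) (map-applyUpTo I (true ∷_) (suc n))))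

  pulledB-split : map (false ∷_) (map pull (allSets n B)) ≡ (false ∷ I 0) ∷ Rest
  pulledB-split = begin
    map (false ∷_) (map pull (allSets n B))
      ≡⟨ sym (map-∘ (allSets n B)) ⟩
    map (λ s → false ∷ pull s) (map I (upTo (suc n)) ++ run I B)
      ≡⟨ map-++ (λ s → false ∷ pull s) (map I (upTo (suc n))) (run I B) ⟩
    map (λ s → false ∷ pull s) (map I (upTo (suc n))) ++ map (λ s → false ∷ pull s) (run I B)
      ≡⟨ cong (_++ map (λ s → false ∷ pull s) (run I B)) initial-part ⟩
    (false ∷ I 0) ∷ Rest ∎
    where
    open ≡-Reasoning
    initial-part : map (λ s → false ∷ pull s) (map I (upTo (suc n))) ≡ (false ∷ I 0) ∷ map (λ k → false ∷ F k) (applyUpTo suc n)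
    initial-part = cong₂ _∷_ (cong (false ∷_) (preimage-initChain π 0))
                             (trans (sym (map-∘ (applyUpTo suc n)))
                                    (map-cong (λ k → cong (false ∷_) (pull-initial k)) (applyUpTo suc n)))

  allSets-combine-↭ : map (true ∷_) (allSets n A) ++ map (false ∷_) (map pull (allSets n B)) ↭ allSets (suc n) (combine n A B)
  allSets-combine-↭ = subst₂ _↭_ (cong (map (true ∷_) (allSets n A) ++_) (sym pulledB-split)) (sym allSets-combine)
                        (shift (false ∷ I 0) (map (true ∷_) (allSets n A)) Rest)

  combine-unique : Unique (allSets n A) → Unique (allSets n B) → Unique (allSets (suc n) (combine n A B))
  combine-unique unique-A unique-B = unique-↭ allSets-combine-↭
    (split-unique unique-A (map-unique pull pull⁻¹ (preimage-inverse (π ⟨$⟩ʳ_) (π ⟨$⟩ˡ_) (λ _ → inverseʳ π)) unique-B))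

  combine-complete : Complete (allSets n A) → Complete (allSets n B) → Complete (allSets (suc n) (combine n A B))
  combine-complete complete-A complete-B = complete-↭ allSets-combine-↭
    (split-complete complete-A (map-complete pull pull⁻¹ (preimage-inverse (π ⟨$⟩ˡ_) (π ⟨$⟩ʳ_) (λ _ → inverseˡ π)) complete-B))

combine-inRange : ∀ {n A B} → All (InRange n) A → All (InRange n) B → All (InRange (suc n)) (combine n A B)
combine-inRange {n} A-ok B-ok =
  All.++⁺ (All.map⁺ (All.map (λ i-ok → s≤s z≤n , inRange-bound i-ok) A-ok))
          (All.++⁺ middle (All.map (λ { (1≤i , i≤n-1) → 1≤i , ≤-trans i≤n-1 (m∸n≤m n 1) }) B-ok))
  where
  middle : All (InRange (suc n)) (map suc (upTo n))
  middle = subst (All (InRange (suc n))) (sym (map-upTo suc n)) (All.applyUpTo⁺₁ suc n (λ i<n → s≤s z≤n , i<n))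

adjacent-suc : ∀ {a b} → Adjacent a b → Adjacent (suc a) (suc b)
adjacent-suc (inj₁ b≡a+1) = inj₁ (cong suc b≡a+1)
adjacent-suc (inj₂ a≡b+1) = inj₂ (cong suc a≡b+1)

-- A+1 ends with 2, followed by 1, 2, …, m+1, followed by B which starts with m.
combine-contiguous : ∀ m A rest → Contiguous A → last A ≡ just 1 → Contiguous (m ∷ rest) →
                     Contiguous (combine (suc m) A (m ∷ rest))
combine-contiguous m A rest contiguous-A A-ends contiguous-B =
  subst (λ middle → Contiguous (map suc A ++ middle ++ m ∷ rest)) (sym (map-upTo suc (suc m)))
    (Linked.++⁺ (Linked.map⁺ (Linked.map adjacent-suc contiguous-A)) ends-next-to-1
                (applyUpTo-linked suc m (m ∷ rest) (λ _ _ → inj₁ refl) (inj₂ refl ∷ contiguous-B)))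
  where
  ends-next-to-1 : Connected Adjacent (last (map suc A)) (just 1)
  ends-next-to-1 = subst (λ x → Connected Adjacent x (just 1))
                         (sym (trans (last-map suc A) (cong (Maybe.map suc) A-ends))) (just (inj₂ refl))

combine-stronglyContiguous : ∀ n A B → StronglyContiguous n A → StronglyContiguous n B →
                             StronglyContiguous (suc n) (combine n A B)
combine-stronglyContiguous zero _ _ ((((() , _) ∷ _) , _) , _ , (_ , refl) , _) _
combine-stronglyContiguous (suc m) A B
  ((A-ok , unique-A , complete-A) , contiguous-A , (restA , refl) , (iniA , A-ends))
  ((B-ok , unique-B , complete-B) , contiguous-B , (restB , refl) , (iniB , B-ends)) =
  (combine-inRange A-ok B-ok , combine-unique unique-A unique-B , combine-complete complete-A complete-B)
  , combine-contiguous m A restB contiguous-A (subst (λ l → last l ≡ just 1) (sym A-ends) (last-∷ʳ iniA 1)) contiguous-B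
  , (map suc restA ++ middle ++ B , refl)
  , (map suc A ++ middle ++ iniB , ends-with-1)
  where
  open Combination {suc m} A B A-ok B-ok
  middle : List ℕ
  middle = map suc (upTo (suc m))
  ends-with-1 : combine (suc m) A B ≡ (map suc A ++ middle ++ iniB) ++ 1 ∷ []
  ends-with-1 = begin
    map suc A ++ middle ++ B                 ≡⟨ cong (λ l → map suc A ++ middle ++ l) B-ends ⟩
    map suc A ++ middle ++ iniB ++ 1 ∷ []    ≡⟨ cong (map suc A ++_) (sym (++-assoc middle iniB (1 ∷ []))) ⟩
    map suc A ++ (middle ++ iniB) ++ 1 ∷ []  ≡⟨ sym (++-assoc (map suc A) (middle ++ iniB) (1 ∷ [])) ⟩
    (map suc A ++ middle ++ iniB) ++ 1 ∷ []  ∎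
    where open ≡-Reasoning

-- R_2 = [1]: the sets are ∅, {0}, {0,1} and the produced set {1}.
R₂-stronglyContiguous : StronglyContiguous 2 (R 2)
R₂-stronglyContiguous = ((s≤s z≤n , s≤s z≤n) ∷ [] , distinct , complete) , [-] , ([] , refl) , ([] , refl)
  where
  distinct : Unique (allSets 2 (R 2))
  distinct = ((λ ()) ∷ (λ ()) ∷ (λ ()) ∷ []) ∷ ((λ ()) ∷ (λ ()) ∷ []) ∷ ((λ ()) ∷ []) ∷ [] ∷ []
  complete : Complete (allSets 2 (R 2))
  complete (false ∷ false ∷ []) = here refl
  complete (true  ∷ false ∷ []) = there (here refl)
  complete (true  ∷ true  ∷ []) = there (there (here refl))
  complete (false ∷ true  ∷ []) = there (there (there (here refl)))

R-stronglyContiguous : ∀ k → StronglyContiguous (suc (suc k)) (R (suc (suc k)))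
R-stronglyContiguous zero    = R₂-stronglyContiguous
R-stronglyContiguous (suc k) = combine-stronglyContiguous (suc (suc k)) _ _ (R-stronglyContiguous k) (R-stronglyContiguous k)

theorem6p2 :
    ((m : ℕ) → 2 ≤ m → StronglyContiguous m (R m) × CyclicGray (grayList m (R m)))
    × ((n : ℕ) (A B : List ℕ) → StronglyContiguous n A → StronglyContiguous n B
        → StronglyContiguous (suc n) (combine n A B))
theorem6p2 = R-properties , combine-stronglyContiguous
  where
  R-properties : (m : ℕ) → 2 ≤ m → StronglyContiguous m (R m) × CyclicGray (grayList m (R m))
  R-properties (suc (suc k)) (s≤s (s≤s z≤n)) =
    R-stronglyContiguous k , stronglyContiguous⇒cyclicGray (suc (suc k)) (R (suc (suc k))) (R-stronglyContiguous k)
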